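{- Let $\mathcal{N}=(P,T,F,m_{init})$ be a Petri net and let $Z\subseteq P$ be the maximal (for inclusion) set of places such that $I_Z=\{m\in\mathbb{N}^P\mid \bigwedge_{p\in Z} m(p)=0\}$ is an inductive invariant of $\mathcal{N}$. For every transition $t\in T$ and every set $Q\subseteq P\setminus Z$, we have $\operatorname{prop}_t(Q)\subseteq P\setminus Z$.
   Context: A Petri net is a tuple $\mathcal{N}=(P,T,F,m_{init})$ with finite disjoint sets $P$ (places) and $T$ (transitions), a flow function $F:(P\times T)\cup(T\times P)\to\mathbb{N}$, and an initial marking $m_{init}\in\mathbb{N}^P$. For $t\in T$, $m\xrightarrow{t}m'$ iff for all $p\in P$: $m(p)\ge F(p,t)$ and $m'(p)=m(p)-F(p,t)+F(t,p)$; $\xrightarrow{*}$ is the reflexive-transitive closure of the union of these relations. A set $I\subseteq\mathbb{N}^P$ is an invariant if it contains every $m$ with $m_{init}\xrightarrow{*}m$; it is an inductive invariant if moreover $m\in I$ and $m\xrightarrow{t}m'$ imply $m'\in I$. (The family of sets $Z$ for which $I_Z$ is an inductive invariant is closed under union, so the maximal such $Z$ exists.) For $t\in T$ and $Q\subseteq P$, define $\operatorname{prop}_t(Q)=\{q\in P\mid F(t,q)>0\}$ if $F(p,t)=0$ for all $p\in P\setminus Q$, and $\operatorname{prop}_t(Q)=\emptyset$ otherwise. -}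

module Defs where

open import Data.Nat using (ℕ; _≤_; _>_; _∸_; _+_)
open import Data.Fin using (Fin)
open import Data.Fin.Subset using (Subset; _∈_; _∉_; _⊆_)
open import Data.Product using (_×_)
open import Relation.Binary.PropositionalEquality using (_≡_)

record PetriNet (np nt : ℕ) : Set where
  field
    Fpt   : Fin np → Fin nt → ℕ
    Ftp   : Fin nt → Fin np → ℕ
    minit : Fin np → ℕ

Marking : ℕ → Set
Marking np = Fin np → ℕ

module _ {np nt : ℕ} (N : PetriNet np nt) where
  open PetriNet N

  Fires : Marking np → Fin nt → Marking np → Set
  Fires m t m' = (p : Fin np) → (Fpt p t ≤ m p) × (m' p ≡ m p ∸ Fpt p t + Ftp t p)

  InI : Subset np → Marking np → Set
  InI Z m = (p : Fin np) → p ∈ Z → m p ≡ 0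

  data Reach : Marking np → Set where
    init : Reach minit
    step : ∀ {m m'} (t : Fin nt) → Reach m → Fires m t m' → Reach m'

  IsInductiveInvariantZ : Subset np → Set
  IsInductiveInvariantZ Z =
      ((m : Marking np) → Reach m → InI Z m)
    × ((m m' : Marking np) (t : Fin nt) → InI Z m → Fires m t m' → InI Z m')

  IsMaximalInvZ : Subset np → Set
  IsMaximalInvZ Z =
    IsInductiveInvariantZ Z
    × ((Z' : Subset np) → IsInductiveInvariantZ Z' → Z' ⊆ Z)

  InProp : Fin nt → Subset np → Fin np → Set
  InProp t Q q = ((p : Fin np) → p ∉ Q → Fpt p t ≡ 0) × (Ftp t q > 0)

-- Only the inductiveness of I_Z matters, not the maximality of Z. The marking
-- m = F(·, t) enables t and lies in I_Z, since its support is inside Q and Q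
-- avoids Z; firing t yields F(t, ·), so every q with F(t, q) > 0 is marked
-- after a step from I_Z and therefore cannot belong to Z.
module Submission where

open import Defs
open import Data.Nat using (ℕ; _>_; _+_)
open import Data.Nat.Properties using (≤-refl; n∸n≡0; <-irrefl)
open import Data.Fin using (Fin)
open import Data.Fin.Subset using (Subset; _∈_; _∉_)
open import Data.Product using (_,_)
open import Relation.Binary.PropositionalEquality using (_≡_; refl; sym; cong; subst)

module _ {np nt : ℕ} (N : PetriNet np nt) where
  open PetriNet N

  preMarking : Fin nt → Marking np
  preMarking t p = Fpt p t

  postMarking : Fin nt → Marking np
  postMarking t p = Ftp t p

  preMarking-fires-postMarking : (t : Fin nt) → Fires N (preMarking t) t (postMarking t)
  preMarking-fires-postMarking t p = ≤-refl , sym (cong (_+ Ftp t p) (n∸n≡0 (Fpt p t)))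

  preMarking-∈-InI : (Z : Subset np) (t : Fin nt) (Q : Subset np) →
    ((p : Fin np) → p ∈ Q → p ∉ Z) → ((p : Fin np) → p ∉ Q → Fpt p t ≡ 0) →
    InI N Z (preMarking t)
  preMarking-∈-InI Z t Q Q∩Z≡∅ pre⊆Q p p∈Z = pre⊆Q p (λ p∈Q → Q∩Z≡∅ p p∈Q p∈Z)

  postMarking-∈-InI : (Z : Subset np) → IsInductiveInvariantZ N Z →
    (t : Fin nt) → InI N Z (preMarking t) → InI N Z (postMarking t)
  postMarking-∈-InI Z (_ , step-closed) t pre∈I =
    step-closed (preMarking t) (postMarking t) t pre∈I (preMarking-fires-postMarking t)

mainTheorem2 : {np nt : ℕ} (N : PetriNet np nt) (Z : Subset np) →
    IsMaximalInvZ N Z →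
    (t : Fin nt) (Q : Subset np) → ((p : Fin np) → p ∈ Q → p ∉ Z) →
    (q : Fin np) → InProp N t Q q → q ∉ Z
mainTheorem2 N Z (invariant , _) t Q Q∩Z≡∅ q (pre⊆Q , Ftq>0) q∈Z =
  <-irrefl refl (subst (_> 0) postq≡0 Ftq>0)
  where
    postq≡0 : postMarking N t q ≡ 0
    postq≡0 = postMarking-∈-InI N Z invariant t
                (preMarking-∈-InI N Z t Q Q∩Z≡∅ pre⊆Q) q q∈Z
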